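{- For $n\in\{2,3\}$ and any fixed prime $p$, the map $m\mapsto D_n(p^m)$ ($m\ge0$) is strictly decreasing.
   Context: For positive integers $k$, $D_n(k)=a'_n(k)/a_n(k)$, where $a_n(k)=\sum_{d_1\cdots d_n=k}d_1^0d_2^1\cdots d_n^{n-1}$ and $a'_n(k)=\sum_{d_1\cdots d_n=k}\prod_{i=1}^n\sum_{g\mid d_i}\mu(g)(d_i/g)^{i-1}$ (sums over tuples of positive integers with product $k$, $\mu$ the Möbius function). Equivalently, $D_n(k)$ is the limiting proportion, as $T\to\infty$, of integer $n\times n$ matrices of determinant $k$ and Frobenius norm at most $T$ whose rows are all primitive vectors. -}

module Defs where

open import Data.Nat as ℕ using (ℕ; zero; suc; _^_; _≟_)
open import Data.Nat.DivMod using (_/_)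
open import Data.Nat.Divisibility using (_∣?_)
open import Data.Nat.Primality using (prime?)
open import Data.Integer as ℤ using (ℤ; +_; -[1+_])
open import Data.Rational as ℚ using (ℚ)
open import Data.Fin using (Fin; toℕ)
open import Data.Vec as Vec using (Vec; []; _∷_; lookup; tabulate)
open import Data.List as List using (List; []; _∷_; upTo; filter; length; concatMap; map)
open import Data.Bool using (Bool; true; false; if_then_else_)
import Data.Bool
open import Data.Product using (_×_)
open import Relation.Nullary using (¬?)
open import Relation.Nullary.Decidable using (_×-dec_; ⌊_⌋)

oneTo : ℕ → List ℕ
oneTo k = map suc (upTo k)

sumℤ : List ℤ → ℤ
sumℤ = List.foldr ℤ._+_ (+ 0)

sumℕ : List ℕ → ℕ
sumℕ = List.foldr ℕ._+_ 0

prodVec : {n : ℕ} → Vec ℕ n → ℕ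
prodVec = Vec.foldr _ ℕ._*_ 1

squarefree : ℕ → Bool
squarefree g = List.foldr Data.Bool._∧_ true (map (λ d → ⌊ ¬? ((d ℕ.* d) ∣? g) ⌋) (map (λ j → suc (suc j)) (upTo g)))

ω : ℕ → ℕ
ω g = length (filter (λ q → prime? q ×-dec q ∣? g) (upTo (suc g)))

μ : ℕ → ℤ
μ g = if squarefree g then (-[1+ 0 ]) ℤ.^ ω g else + 0

J : ℕ → ℕ → ℤ
J e d = sumℤ (List.map term (upTo d))
  where
  term : ℕ → ℤ
  term j with (suc j) ∣? d
  ... | Relation.Nullary.yes _ = μ (suc j) ℤ.* (+ ((d / suc j) ^ e))
  ... | Relation.Nullary.no  _ = + 0

vecsOver : (n : ℕ) → List ℕ → List (Vec ℕ n)
vecsOver zero    xs = [] ∷ []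
vecsOver (suc n) xs = concatMap (λ x → map (x ∷_) (vecsOver n xs)) xs

factorisations : (n k : ℕ) → List (Vec ℕ n)
factorisations n k = filter (λ v → prodVec v ≟ k) (vecsOver n (oneTo k))

a : ℕ → ℕ → ℕ
a n k = sumℕ (map (λ v → prodVec (tabulate (λ (i : Fin n) → lookup v i ^ toℕ i)))
                  (factorisations n k))

a′ : ℕ → ℕ → ℤ
a′ n k = sumℤ (map (λ v → Vec.foldr _ ℤ._*_ (+ 1) (tabulate (λ (i : Fin n) → J (toℕ i) (lookup v i))))
                   (factorisations n k))

-- rational quotient x / d, with a junk value 0 when d = 0 (never used: a_n(k) ≥ 1 for k ≥ 1)
divℚ : ℤ → ℕ → ℚ
divℚ x zero    = ℚ.0ℚ
divℚ x (suc d) = x ℚ./ suc d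

D : ℕ → ℕ → ℚ
D n k = divℚ (a′ n k) (a n k)

-- For k = p ^ m every divisor of k is a power of p, so a_n(p^m) and a′_n(p^m) become sums over
-- exponent vectors (e₁,…,eₙ) with e₁ + ⋯ + eₙ = m. As μ(1) = 1, μ(p) = -1 and μ vanishes on higher
-- powers of p, J_e(1) = 1 and J_e(p^(k+1)) = p^((k+1)e) - p^(ke); in particular J_0(p^k) = [k = 0].
-- With X = p^m this gives closed forms
--   (p-1) a₂(p^m) = pX - 1,  a′₂(p^(m+1)) = (p-1) X,
--   (p-1)(p²-1) a₃(p^m) = (pX - 1)(p²X - 1),  p a′₃(p^(m+1)) = (p-1) X ((p+1)² X - 1),
-- and after clearing denominators D_n(p^(m+1)) < D_n(p^m) becomes a polynomial identity in p and X
-- whose remainder is a product of positive factors, e.g. (p-1)² X (p³X - 1)(X(3p²+3p+1) - 1)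
-- for n = 3, m ≥ 1.

module Submission where

open import Defs
open import Data.Nat using (ℕ; _^_; _<_)
open import Data.Nat.Primality using (Prime)
open import Data.Rational using () renaming (_<_ to _<ℚ_)
open import Data.Sum using (_⊎_)
open import Relation.Binary.PropositionalEquality using (_≡_)

open import Data.Nat as ℕ using (zero; suc; _∸_; _≤_; _≟_; z≤n; s≤s; z<s; s<s)
import Data.Nat.Properties as ℕ
open import Data.Nat.Divisibility using (_∣_; _∣?_; divides; ∣-refl; ∣-trans; 1∣_; m∣m*n; ∣1⇒≡1; ∣⇒≤)
open import Data.Nat.Coprimality using (Coprime; coprime-divisor)
open import Data.Nat.Primality using (prime⇒irreducible; prime?; ¬prime[0]; ¬prime[1])
open import Data.Nat.DivMod using (_/_; n/1≡n; m*n/n≡m; /-congˡ; /-congʳ)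
open import Data.Integer as ℤ using (ℤ; +_; 0ℤ; 1ℤ; -1ℤ; _+_; _*_; -_; _-_)
import Data.Integer.Properties as ℤ
open import Data.Integer.Tactic.RingSolver using (solve-∀)
open import Data.Rational as ℚ using (ℚ)
import Data.Rational.Properties as ℚ
import Data.Rational.Unnormalised as ℚᵘ
import Data.Rational.Unnormalised.Properties as ℚᵘ
open import Data.List using (List; []; _∷_; _++_; map; filter; concatMap; upTo; applyUpTo; length)
open import Data.Bool.ListAction using (and)
import Data.List.Properties as List
open import Data.List.Membership.Propositional using (_∈_)
open import Data.List.Membership.Propositional.Properties using (∈-map⁺; ∈-upTo⁺)
open import Data.List.Relation.Unary.Any using (here; there)
open import Data.Vec as Vec using (Vec; []; _∷_; lookup; tabulate)
open import Data.Fin using (Fin; toℕ)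
open import Data.Bool using (Bool; true; false; if_then_else_; _∧_)
import Data.Bool.Properties as Bool
open import Data.Product using (_×_; _,_)
open import Data.Sum using (inj₁; inj₂)
open import Data.Empty using (⊥-elim)
open import Function using (_∘_; id)
open import Relation.Nullary using (Dec; yes; no; does; ¬_)
open import Relation.Nullary.Decidable using (dec-true; dec-false; _×-dec_; ¬?; ⌊_⌋)
open import Relation.Binary.PropositionalEquality
  using (refl; sym; trans; cong; cong₂; subst; subst₂; module ≡-Reasoning)

private
  variable
    A B : Set

-- Finite sums

sumMap : (A → ℤ) → List A → ℤ
sumMap f xs = sumℤ (map f xs)

sumMap-cong : ∀ {f g : A → ℤ} → (∀ x → f x ≡ g x) → ∀ xs → sumMap f xs ≡ sumMap g xs
sumMap-cong f≡g []       = refl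
sumMap-cong f≡g (x ∷ xs) = cong₂ _+_ (f≡g x) (sumMap-cong f≡g xs)

sumMap-zero : ∀ {f : A → ℤ} → (∀ x → f x ≡ 0ℤ) → ∀ xs → sumMap f xs ≡ 0ℤ
sumMap-zero f≡0 []       = refl
sumMap-zero f≡0 (x ∷ xs) = cong₂ _+_ (f≡0 x) (sumMap-zero f≡0 xs)

sumMap-++ : ∀ (f : A → ℤ) xs ys → sumMap f (xs ++ ys) ≡ sumMap f xs + sumMap f ys
sumMap-++ f []       ys = sym (ℤ.+-identityˡ _)
sumMap-++ f (x ∷ xs) ys = trans (cong (_+_ (f x)) (sumMap-++ f xs ys)) (sym (ℤ.+-assoc (f x) _ _))

sumMap-map : ∀ (f : B → ℤ) (g : A → B) xs → sumMap f (map g xs) ≡ sumMap (f ∘ g) xs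
sumMap-map f g []       = refl
sumMap-map f g (x ∷ xs) = cong (_+_ (f (g x))) (sumMap-map f g xs)

sumMap-concatMap : ∀ (f : B → ℤ) (g : A → List B) xs →
  sumMap f (concatMap g xs) ≡ sumMap (sumMap f ∘ g) xs
sumMap-concatMap f g []       = refl
sumMap-concatMap f g (x ∷ xs) =
  trans (sumMap-++ f (g x) (concatMap g xs)) (cong (_+_ (sumMap f (g x))) (sumMap-concatMap f g xs))

sumMap-filter : ∀ {P : A → Set} (P? : ∀ x → Dec (P x)) (f : A → ℤ) xs →
  sumMap f (filter P? xs) ≡ sumMap (λ x → if does (P? x) then f x else 0ℤ) xs
sumMap-filter P? f []       = refl
sumMap-filter P? f (x ∷ xs) with does (P? x)
... | true  = cong (_+_ (f x)) (sumMap-filter P? f xs)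
... | false = trans (sumMap-filter P? f xs) (sym (ℤ.+-identityˡ _))

+sumℕ-map : ∀ (f : A → ℕ) xs → + sumℕ (map f xs) ≡ sumMap (+_ ∘ f) xs
+sumℕ-map f []       = refl
+sumℕ-map f (x ∷ xs) = trans (ℤ.pos-+ (f x) _) (cong (_+_ (+ f x)) (+sumℕ-map f xs))

+length≡sumMap-1 : ∀ (xs : List A) → + length xs ≡ sumMap (λ _ → 1ℤ) xs
+length≡sumMap-1 []       = refl
+length≡sumMap-1 (x ∷ xs) = cong (_+_ 1ℤ) (+length≡sumMap-1 xs)

Σ< : ℕ → (ℕ → ℤ) → ℤ
Σ< zero    f = 0ℤ
Σ< (suc K) f = f 0 + Σ< K (f ∘ suc)

sumMap-applyUpTo : ∀ (f : A → ℤ) (g : ℕ → A) K → sumMap f (applyUpTo g K) ≡ Σ< K (f ∘ g)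
sumMap-applyUpTo f g zero    = refl
sumMap-applyUpTo f g (suc K) = cong (_+_ (f (g 0))) (sumMap-applyUpTo f (g ∘ suc) K)

sumMap-oneTo : ∀ (f : ℕ → ℤ) K → sumMap f (oneTo K) ≡ Σ< K (f ∘ suc)
sumMap-oneTo f K = trans (sumMap-map f suc (upTo K)) (sumMap-applyUpTo (f ∘ suc) id K)

Σ<-cong : ∀ {f g : ℕ → ℤ} K → (∀ i → i < K → f i ≡ g i) → Σ< K f ≡ Σ< K g
Σ<-cong zero    f≡g = refl
Σ<-cong (suc K) f≡g = cong₂ _+_ (f≡g 0 z<s) (Σ<-cong K (λ i i<K → f≡g (suc i) (s<s i<K)))

Σ<-zero : ∀ {f : ℕ → ℤ} K → (∀ i → f i ≡ 0ℤ) → Σ< K f ≡ 0ℤ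
Σ<-zero zero    f≡0 = refl
Σ<-zero (suc K) f≡0 = cong₂ _+_ (f≡0 0) (Σ<-zero K (f≡0 ∘ suc))

Σ<-head : ∀ K (f : ℕ → ℤ) → (∀ i → f (suc i) ≡ 0ℤ) → Σ< (suc K) f ≡ f 0
Σ<-head K f f≡0 = trans (cong (_+_ (f 0)) (Σ<-zero K f≡0)) (ℤ.+-identityʳ (f 0))

Σ<-+ : ∀ (f g : ℕ → ℤ) K → Σ< K (λ i → f i + g i) ≡ Σ< K f + Σ< K g
Σ<-+ f g zero    = refl
Σ<-+ f g (suc K) = trans (cong (_+_ (f 0 + g 0)) (Σ<-+ (f ∘ suc) (g ∘ suc) K)) (interchange (f 0) (g 0) _ _)
  where
  interchange : ∀ a b c d → (a + b) + (c + d) ≡ (a + c) + (b + d)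
  interchange = solve-∀

Σ<-*ˡ : ∀ c (f : ℕ → ℤ) K → Σ< K (λ i → c * f i) ≡ c * Σ< K f
Σ<-*ˡ c f zero    = sym (ℤ.*-zeroʳ c)
Σ<-*ˡ c f (suc K) = trans (cong (_+_ (c * f 0)) (Σ<-*ˡ c (f ∘ suc) K)) (sym (ℤ.*-distribˡ-+ c (f 0) _))

Σ<-snoc : ∀ (f : ℕ → ℤ) K → Σ< (suc K) f ≡ Σ< K f + f K
Σ<-snoc f zero    = trans (ℤ.+-identityʳ (f 0)) (sym (ℤ.+-identityˡ (f 0)))
Σ<-snoc f (suc K) = trans (cong (_+_ (f 0)) (Σ<-snoc (f ∘ suc) K)) (sym (ℤ.+-assoc (f 0) _ _))

Σ<-indicator : ∀ K w (h : ℕ → ℤ) → w < K → Σ< K (λ i → if does (i ≟ w) then h i else 0ℤ) ≡ h w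
Σ<-indicator (suc K) zero    h _ = Σ<-head K (λ i → if does (i ≟ 0) then h i else 0ℤ) (λ _ → refl)
Σ<-indicator (suc K) (suc w) h (s<s w<K) = trans (ℤ.+-identityˡ _) (Σ<-indicator K w (h ∘ suc) w<K)

Σ<-indicator-suc : ∀ K w (h : ℕ → ℤ) → 0 < w → w ≤ K →
  Σ< K (λ i → if does (suc i ≟ w) then h (suc i) else 0ℤ) ≡ h w
Σ<-indicator-suc K (suc w) h _ w<K = Σ<-indicator K w (h ∘ suc) w<K

Σ<-last : ∀ M (g : ℕ → ℤ) → Σ< (suc M) (λ j → if does (M ∸ j ≟ 0) then g j else 0ℤ) ≡ g M
Σ<-last zero    g = ℤ.+-identityʳ (g 0)
Σ<-last (suc M) g = trans (ℤ.+-identityˡ _) (Σ<-last M (g ∘ suc))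

if-true : ∀ {P : Set} (P? : Dec P) {x y : A} → P → (if does P? then x else y) ≡ x
if-true P? p rewrite dec-true P? p = refl

if-false : ∀ {P : Set} (P? : Dec P) {x y : A} → ¬ P → (if does P? then x else y) ≡ y
if-false P? ¬p rewrite dec-false P? ¬p = refl

if-cong : ∀ {P Q : Set} (P? : Dec P) (Q? : Dec Q) {x y : A} → (P → Q) → (Q → P) →
  (if does P? then x else y) ≡ (if does Q? then x else y)
if-cong (yes p) Q? P⇒Q Q⇒P = sym (if-true Q? (P⇒Q p))
if-cong (no ¬p) Q? P⇒Q Q⇒P = sym (if-false Q? (¬p ∘ Q⇒P))

⌊¬?⌋≡true : ∀ {P : Set} (P? : Dec P) → ¬ P → ⌊ ¬? P? ⌋ ≡ true
⌊¬?⌋≡true (yes p) ¬p = ⊥-elim (¬p p)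
⌊¬?⌋≡true (no _)  _  = refl

⌊¬?⌋≡false : ∀ {P : Set} (P? : Dec P) → P → ⌊ ¬? P? ⌋ ≡ false
⌊¬?⌋≡false (yes _) _ = refl
⌊¬?⌋≡false (no ¬p) p = ⊥-elim (¬p p)

and-map-true : ∀ (b : A → Bool) xs → (∀ x → b x ≡ true) → and (map b xs) ≡ true
and-map-true b []       b≡true = refl
and-map-true b (x ∷ xs) b≡true = cong₂ _∧_ (b≡true x) (and-map-true b xs b≡true)

and-map-false : ∀ (b : A → Bool) {x} xs → x ∈ xs → b x ≡ false → and (map b xs) ≡ false
and-map-false b (y ∷ ys) (here refl) bx≡false = cong (_∧ and (map b ys)) bx≡false
and-map-false b (y ∷ ys) (there x∈ys) bx≡false =
  trans (cong (b y ∧_) (and-map-false b ys x∈ys bx≡false)) (Bool.∧-zeroʳ (b y))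

-- Arithmetic in ℤ and ℚ

*-pos : ∀ {x y} → 0ℤ ℤ.< x → 0ℤ ℤ.< y → 0ℤ ℤ.< x * y
*-pos {x} 0<x 0<y = subst (ℤ._< x * _) (ℤ.*-zeroʳ x) (ℤ.*-monoˡ-<-pos x {{ℤ.positive 0<x}} 0<y)

+-pos : ∀ {x y} → 0ℤ ℤ.< x → 0ℤ ℤ.< y → 0ℤ ℤ.< x + y
+-pos = ℤ.+-mono-<

*-cancelˡ-pos : ∀ k {x} → 0ℤ ℤ.< k → 0ℤ ℤ.< k * x → 0ℤ ℤ.< x
*-cancelˡ-pos k {x} 0<k 0<kx =
  ℤ.*-cancelˡ-<-nonNeg k {{ℤ.nonNegative (ℤ.<⇒≤ 0<k)}} (subst (ℤ._< k * x) (sym (ℤ.*-zeroʳ k)) 0<kx)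

<-by-scaling : ∀ k {x y} d → 0ℤ ℤ.< k → 0ℤ ℤ.< d → k * y ≡ k * x + d → x ℤ.< y
<-by-scaling k {x} d 0<k 0<d ky≡kx+d = ℤ.*-cancelˡ-<-nonNeg k {{ℤ.nonNegative (ℤ.<⇒≤ 0<k)}}
  (subst (k * x ℤ.<_) (sym ky≡kx+d)
         (subst (ℤ._< k * x + d) (ℤ.+-identityʳ (k * x)) (ℤ.+-monoʳ-< (k * x) 0<d)))

<-by-cross-scaling : ∀ k l {b b′ a a′} d → 0ℤ ℤ.< k → 0ℤ ℤ.< l → 0ℤ ℤ.< d →
  k * b * (l * a′) ≡ k * b′ * (l * a) + d → b′ * a ℤ.< b * a′
<-by-cross-scaling k l {b} {b′} {a} {a′} d 0<k 0<l 0<d eq = <-by-scaling (k * l) d (*-pos 0<k 0<l) 0<d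
  (trans (regroup k l b a′) (trans eq (cong (_+ d) (sym (regroup k l b′ a)))))
  where
  regroup : ∀ k l b a → k * l * (b * a) ≡ k * b * (l * a)
  regroup = solve-∀

+-1-pos : ∀ {n} → 1 < n → 0ℤ ℤ.< + n - 1ℤ
+-1-pos {suc (suc n)} _ = ℤ.+<+ z<s
+-1-pos {suc zero} (s<s ())

divℚ-< : ∀ x y {m n} → 0 < m → 0 < n → x * + n ℤ.< y * + m → divℚ x m <ℚ divℚ y n
divℚ-< x y {suc m} {suc n} _ _ xn<ym = ℚ.toℚᵘ-cancel-<
  (ℚᵘ.<-respˡ-≃ (ℚᵘ.≃-sym (ℚ.toℚᵘ-fromℚᵘ (ℚᵘ.mkℚᵘ x m)))
  (ℚᵘ.<-respʳ-≃ (ℚᵘ.≃-sym (ℚ.toℚᵘ-fromℚᵘ (ℚᵘ.mkℚᵘ y n))) (ℚᵘ.*<* xn<ym)))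

aSummand : (n : ℕ) → Vec ℕ n → ℕ
aSummand n v = prodVec (tabulate (λ (i : Fin n) → lookup v i ^ toℕ i))

a′Summand : (n : ℕ) → Vec ℕ n → ℤ
a′Summand n v = Vec.foldr _ _*_ 1ℤ (tabulate (λ (i : Fin n) → J (toℕ i) (lookup v i)))

aSummand-2 : ∀ x y → aSummand 2 (x ∷ y ∷ []) ≡ y
aSummand-2 x y = trans (ℕ.*-identityˡ _) (trans (ℕ.*-identityʳ _) (ℕ.*-identityʳ y))

aSummand-3 : ∀ x y z → aSummand 3 (x ∷ y ∷ z ∷ []) ≡ y ℕ.* (z ℕ.* z)
aSummand-3 x y z = trans (ℕ.*-identityˡ _)
  (cong₂ ℕ._*_ (ℕ.*-identityʳ y) (trans (ℕ.*-identityʳ _) (cong (z ℕ.*_) (ℕ.*-identityʳ z))))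

divisorTerm : ℕ → ℕ → ℕ → ℤ
divisorTerm e d zero        = 0ℤ
divisorTerm e d g@(suc _)   = if does (g ∣? d) then μ g * + ((d / g) ^ e) else 0ℤ

divisorTerm-∣ : ∀ e d g .{{_ : ℕ.NonZero g}} → g ∣ d → divisorTerm e d g ≡ μ g * + ((d / g) ^ e)
divisorTerm-∣ e d (suc g) g∣d = if-true (suc g ∣? d) g∣d

divisorTerm-∤ : ∀ e d g → ¬ g ∣ d → divisorTerm e d g ≡ 0ℤ
divisorTerm-∤ e d zero    _   = refl
divisorTerm-∤ e d (suc g) g∤d = if-false (suc g ∣? d) g∤d

divisorTerm-μ≡0 : ∀ e d g → μ g ≡ 0ℤ → divisorTerm e d g ≡ 0ℤ
divisorTerm-μ≡0 e d zero    _    = refl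
divisorTerm-μ≡0 e d (suc g) μg≡0 with does (suc g ∣? d)
... | true  = cong (_* + ((d / suc g) ^ e)) μg≡0
... | false = refl

J-≡-Σ<-divisorTerm : ∀ e d → J e d ≡ Σ< d (divisorTerm e d ∘ suc)
J-≡-Σ<-divisorTerm e d = trans J-unfold (trans (sumMap-applyUpTo summand id d) (Σ<-cong d (λ j _ → summand≡ j)))
  where
  -- the summand of J is local to its definition, so it can only be named by unification
  summand : ℕ → ℤ
  summand = _
  J-unfold : J e d ≡ sumMap summand (upTo d)
  J-unfold = refl
  summand≡ : ∀ j → summand j ≡ divisorTerm e d (suc j)
  summand≡ j with suc j ∣? d
  ... | yes j∣d = sym (if-true (suc j ∣? d) j∣d)
  ... | no  j∤d = sym (if-false (suc j ∣? d) j∤d)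

-- Prime powers

-- p is written 2 + q so that p - 1 and polynomials in p with positive coefficients reduce to
-- visibly positive integers, which ℤ.positive⁻¹ then accepts.
module PrimePower (q : ℕ) (p-prime : Prime (2 ℕ.+ q)) where

  p : ℕ
  p = 2 ℕ.+ q

  p^-nonZero : ∀ k → ℕ.NonZero (p ^ k)
  p^-nonZero k = ℕ.m^n≢0 p k

  1<p^suc : ∀ k → 1 < p ^ suc k
  1<p^suc k = ℕ.^-monoʳ-< p (s<s z<s) {0} {suc k} z<s

  1≡p^⇒≡0 : ∀ {M} → 1 ≡ p ^ M → M ≡ 0
  1≡p^⇒≡0 {zero}  _    = refl
  1≡p^⇒≡0 {suc M} 1≡p^ = ⊥-elim (ℕ.<⇒≢ (1<p^suc M) 1≡p^)

  p^-split : ∀ {j M} → j ≤ M → p ^ j ℕ.* p ^ (M ∸ j) ≡ p ^ M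
  p^-split {j} {M} j≤M = trans (sym (ℕ.^-distribˡ-+-* p j (M ∸ j))) (cong (p ^_) (ℕ.m+[n∸m]≡n j≤M))

  p^-mono-∣ : ∀ {j M} → j ≤ M → p ^ j ∣ p ^ M
  p^-mono-∣ {j} {M} j≤M = divides (p ^ (M ∸ j)) (trans (sym (p^-split j≤M)) (ℕ.*-comm (p ^ j) _))

  p^suc∤p^ : ∀ M → ¬ p ^ suc M ∣ p ^ M
  p^suc∤p^ M p^sucM∣p^M =
    ℕ.<⇒≱ (ℕ.^-monoʳ-< p (s<s z<s) {M} {suc M} (ℕ.n<1+n M)) (∣⇒≤ {{p^-nonZero M}} p^sucM∣p^M)

  coprime-∣p^⇒≡1 : ∀ k c → ¬ p ∣ c → c ∣ p ^ k → c ≡ 1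
  coprime-∣p^⇒≡1 zero    c p∤c c∣1 = ∣1⇒≡1 c∣1
  coprime-∣p^⇒≡1 (suc k) c p∤c c∣p^ = coprime-∣p^⇒≡1 k c p∤c (coprime-divisor c⊥p c∣p^)
    where
    c⊥p : Coprime c p
    c⊥p (i∣c , i∣p) with prime⇒irreducible p-prime i∣p
    ... | inj₁ i≡1 = i≡1
    ... | inj₂ refl = ⊥-elim (p∤c i∣c)

  ∣p^suc∧∤p^⇒≡ : ∀ {M d} → d ∣ p ^ suc M → ¬ d ∣ p ^ M → d ≡ p ^ suc M
  ∣p^suc∧∤p^⇒≡ {M} {d} (divides c p^sucM≡cd) d∤p^M with p ∣? c
  ... | yes (divides r c≡rp) = ⊥-elim (d∤p^M (divides r (ℕ.*-cancelˡ-≡ (p ^ M) (r ℕ.* d) p p·p^M≡p·rd)))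
    where
    p·p^M≡p·rd : p ℕ.* p ^ M ≡ p ℕ.* (r ℕ.* d)
    p·p^M≡p·rd = trans p^sucM≡cd (trans (cong (ℕ._* d) (trans c≡rp (ℕ.*-comm r p))) (ℕ.*-assoc p r d))
  ... | no p∤c = trans (sym (ℕ.*-identityˡ d)) (trans (cong (ℕ._* d) (sym c≡1)) (sym p^sucM≡cd))
    where
    c≡1 : c ≡ 1
    c≡1 = coprime-∣p^⇒≡1 (suc M) c p∤c (divides d (trans p^sucM≡cd (ℕ.*-comm c d)))

  Σ<-divisors-p^ : ∀ M K (t : ℕ → ℤ) → p ^ M ≤ K → (∀ d → ¬ d ∣ p ^ M → t d ≡ 0ℤ) →
    Σ< K (t ∘ suc) ≡ Σ< (suc M) (t ∘ (p ^_))
  Σ<-divisors-p^ zero (suc K) t _ t≡0 =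
    cong (_+_ (t 1)) (Σ<-zero K (λ i → t≡0 (2 ℕ.+ i) (λ 2+i∣1 → ℕ.<⇒≢ (s<s z<s) (sym (∣1⇒≡1 2+i∣1)))))
  Σ<-divisors-p^ (suc M) K t p^sucM≤K t≡0 = begin
      Σ< K (t ∘ suc)
    ≡⟨ Σ<-cong K (λ i _ → split (suc i)) ⟩
      Σ< K (λ i → t′ (suc i) + top (suc i))
    ≡⟨ Σ<-+ (t′ ∘ suc) (top ∘ suc) K ⟩
      Σ< K (t′ ∘ suc) + Σ< K (top ∘ suc)
    ≡⟨ cong₂ _+_ (Σ<-divisors-p^ M K t′ p^M≤K t′≡0)
                 (Σ<-indicator-suc K (p ^ suc M) t (ℕ.m^n>0 p (suc M)) p^sucM≤K) ⟩
      Σ< (suc M) (t′ ∘ (p ^_)) + t (p ^ suc M)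
    ≡⟨ cong (_+ t (p ^ suc M)) (Σ<-cong {t′ ∘ (p ^_)} {t ∘ (p ^_)} (suc M)
         (λ j j<1+M → if-true (p ^ j ∣? p ^ M) (p^-mono-∣ (ℕ.≤-pred j<1+M)))) ⟩
      Σ< (suc M) (t ∘ (p ^_)) + t (p ^ suc M)
    ≡⟨ Σ<-snoc (t ∘ (p ^_)) (suc M) ⟨
      Σ< (suc (suc M)) (t ∘ (p ^_)) ∎
    where
    open ≡-Reasoning
    t′ top : ℕ → ℤ
    t′  d = if does (d ∣? p ^ M) then t d else 0ℤ
    top d = if does (d ≟ p ^ suc M) then t d else 0ℤ
    p^M≤K : p ^ M ≤ K
    p^M≤K = ℕ.≤-trans (ℕ.^-monoʳ-≤ p (ℕ.n≤1+n M)) p^sucM≤K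
    t′≡0 : ∀ d → ¬ d ∣ p ^ M → t′ d ≡ 0ℤ
    t′≡0 d d∤ = if-false (d ∣? p ^ M) d∤
    split : ∀ d → t d ≡ t′ d + top d
    split d with d ∣? p ^ M
    ... | yes d∣p^M = sym (trans (cong (_+_ (t d)) (if-false (d ≟ p ^ suc M) λ { refl → p^suc∤p^ M d∣p^M }))
                                 (ℤ.+-identityʳ (t d)))
    ... | no d∤p^M with d ∣? p ^ suc M
    ...   | yes d∣ = sym (trans (ℤ.+-identityˡ (top d))
                                (if-true (d ≟ p ^ suc M) (∣p^suc∧∤p^⇒≡ {M} d∣ d∤p^M)))
    ...   | no d∤  = trans (t≡0 d d∤)
                       (sym (trans (ℤ.+-identityˡ (top d)) (if-false (d ≟ p ^ suc M) λ { refl → d∤ ∣-refl })))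

  squarefree-p : squarefree p ≡ true
  squarefree-p = trans (cong and (sym (List.map-∘ {g = d²∤p} {f = 2 ℕ.+_} (upTo p))))
                       (and-map-true (d²∤p ∘ (2 ℕ.+_)) (upTo p) (λ j → ⌊¬?⌋≡true (_ ∣? p) (dd∤p (s<s z<s))))
    where
    d²∤p : ℕ → Bool
    d²∤p d = ⌊ ¬? (d ℕ.* d ∣? p) ⌋
    dd∤p : ∀ {d} → 1 < d → ¬ d ℕ.* d ∣ p
    dd∤p {d} 1<d dd∣p with prime⇒irreducible p-prime {d} (∣-trans (m∣m*n d) dd∣p)
    ... | inj₁ refl = ℕ.<-irrefl refl 1<d
    ... | inj₂ refl = ℕ.<⇒≱ (ℕ.m<m*n p p (s<s z<s)) (∣⇒≤ dd∣p)

  squarefree-p^2+ : ∀ i → squarefree (p ^ (2 ℕ.+ i)) ≡ false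
  squarefree-p^2+ i = and-map-false _ (map (2 ℕ.+_) (upTo (p ^ (2 ℕ.+ i))))
    (∈-map⁺ (2 ℕ.+_) (∈-upTo⁺ q<p^2+i)) (⌊¬?⌋≡false (_ ∣? p ^ (2 ℕ.+ i)) pp∣p^2+i)
    where
    q<p^2+i : q < p ^ (2 ℕ.+ i)
    q<p^2+i = ℕ.<-≤-trans (s≤s (ℕ.n≤1+n q)) (ℕ.m≤m*n p (p ^ suc i) {{p^-nonZero (suc i)}})
    pp∣p^2+i : p ℕ.* p ∣ p ^ (2 ℕ.+ i)
    pp∣p^2+i = divides (p ^ i) (trans (sym (ℕ.*-assoc p p (p ^ i))) (ℕ.*-comm (p ℕ.* p) (p ^ i)))

  ω-p : ω p ≡ 1
  ω-p = ℤ.+-injective (begin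
      + ω p
    ≡⟨ +length≡sumMap-1 (filter P? (upTo (suc p))) ⟩
      sumMap (λ _ → 1ℤ) (filter P? (upTo (suc p)))
    ≡⟨ sumMap-filter P? (λ _ → 1ℤ) (upTo (suc p)) ⟩
      sumMap (λ r → if does (P? r) then 1ℤ else 0ℤ) (upTo (suc p))
    ≡⟨ sumMap-applyUpTo (λ r → if does (P? r) then 1ℤ else 0ℤ) id (suc p) ⟩
      Σ< (suc p) (λ r → if does (P? r) then 1ℤ else 0ℤ)
    ≡⟨ Σ<-cong {λ r → if does (P? r) then 1ℤ else 0ℤ} (suc p)
         (λ r _ → if-cong (P? r) (r ≟ p) prime∣p⇒≡p (λ { refl → p-prime , ∣-refl })) ⟩
      Σ< (suc p) (λ r → if does (r ≟ p) then 1ℤ else 0ℤ)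
    ≡⟨ Σ<-indicator (suc p) p (λ _ → 1ℤ) (ℕ.n<1+n p) ⟩
      1ℤ ∎)
    where
    open ≡-Reasoning
    P? : ∀ r → Dec (Prime r × r ∣ p)
    P? r = prime? r ×-dec r ∣? p
    prime∣p⇒≡p : ∀ {r} → Prime r × r ∣ p → r ≡ p
    prime∣p⇒≡p (r-prime , r∣p) with prime⇒irreducible p-prime r∣p
    ... | inj₁ refl = ⊥-elim (¬prime[1] r-prime)
    ... | inj₂ r≡p  = r≡p

  μ-p : μ p ≡ -1ℤ
  μ-p = trans (cong (if_then -1ℤ ℤ.^ ω p else 0ℤ) squarefree-p) (cong (-1ℤ ℤ.^_) ω-p)

  μ-p^2+ : ∀ i → μ (p ^ (2 ℕ.+ i)) ≡ 0ℤ
  μ-p^2+ i = cong (if_then -1ℤ ℤ.^ ω (p ^ (2 ℕ.+ i)) else 0ℤ) (squarefree-p^2+ i)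

  J-p^ : ∀ e M → J e (p ^ M) ≡ Σ< (suc M) (λ j → divisorTerm e (p ^ M) (p ^ j))
  J-p^ e M = trans (J-≡-Σ<-divisorTerm e (p ^ M))
    (Σ<-divisors-p^ M (p ^ M) (divisorTerm e (p ^ M)) ℕ.≤-refl (divisorTerm-∤ e (p ^ M)))

  J-p^0 : ∀ e → J e (p ^ 0) ≡ 1ℤ
  J-p^0 e = trans (J-p^ e 0) (trans (ℤ.+-identityʳ _) (trans (ℤ.*-identityˡ _) (cong +_ (ℕ.^-zeroˡ e))))

  J-p^suc : ∀ e M → J e (p ^ suc M) ≡ + ((p ^ suc M) ^ e) - + ((p ^ M) ^ e)
  J-p^suc e M = begin
      J e (p ^ suc M)
    ≡⟨ J-p^ e (suc M) ⟩
      term 1 + (term (p ^ 1) + Σ< M (λ j → term (p ^ (2 ℕ.+ j))))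
    ≡⟨ cong₂ (λ x y → x + (y + Σ< M (λ j → term (p ^ (2 ℕ.+ j))))) term-1 term-p ⟩
      + ((p ^ suc M) ^ e) + (- + ((p ^ M) ^ e) + Σ< M (λ j → term (p ^ (2 ℕ.+ j))))
    ≡⟨ cong (λ s → + ((p ^ suc M) ^ e) + (- + ((p ^ M) ^ e) + s)) (Σ<-zero M term-p^2+) ⟩
      + ((p ^ suc M) ^ e) + (- + ((p ^ M) ^ e) + 0ℤ)
    ≡⟨ cong (_+_ (+ ((p ^ suc M) ^ e))) (ℤ.+-identityʳ (- + ((p ^ M) ^ e))) ⟩
      + ((p ^ suc M) ^ e) - + ((p ^ M) ^ e) ∎
    where
    open ≡-Reasoning
    term : ℕ → ℤ
    term = divisorTerm e (p ^ suc M)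
    term-1 : term 1 ≡ + ((p ^ suc M) ^ e)
    term-1 = trans (divisorTerm-∣ e (p ^ suc M) 1 (1∣ _))
                   (trans (ℤ.*-identityˡ _) (cong (λ x → + (x ^ e)) (n/1≡n (p ^ suc M))))
    p^sucM/p≡p^M : (p ^ suc M / p ^ 1) {{p^-nonZero 1}} ≡ p ^ M
    p^sucM/p≡p^M = trans (/-congʳ {m = p ^ suc M} {{p^-nonZero 1}} (ℕ.*-identityʳ p))
                         (trans (/-congˡ (ℕ.*-comm p (p ^ M))) (m*n/n≡m (p ^ M) p))
    term-p : term (p ^ 1) ≡ - + ((p ^ M) ^ e)
    term-p = begin
        term (p ^ 1)
      ≡⟨ divisorTerm-∣ e (p ^ suc M) (p ^ 1) {{p^-nonZero 1}} (p^-mono-∣ {1} {suc M} (s≤s z≤n)) ⟩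
        μ (p ^ 1) * + ((p ^ suc M / p ^ 1) {{p^-nonZero 1}} ^ e)
      ≡⟨ cong₂ (λ m x → m * + (x ^ e)) (trans (cong μ (ℕ.*-identityʳ p)) μ-p) p^sucM/p≡p^M ⟩
        -1ℤ * + ((p ^ M) ^ e)
      ≡⟨ ℤ.-1*i≡-i _ ⟩
        - + ((p ^ M) ^ e) ∎
    term-p^2+ : ∀ j → term (p ^ (2 ℕ.+ j)) ≡ 0ℤ
    term-p^2+ j = divisorTerm-μ≡0 e (p ^ suc M) (p ^ (2 ℕ.+ j)) (μ-p^2+ j)

  -- Σ-exponents n M G sums G (p ^ e₁ , … , p ^ eₙ) over all (e₁ , … , eₙ) with e₁ + ⋯ + eₙ = M
  Σ-exponents : (n M : ℕ) → (Vec ℕ n → ℤ) → ℤ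
  Σ-exponents zero    M G = if does (M ≟ 0) then G [] else 0ℤ
  Σ-exponents (suc n) M G = Σ< (suc M) (λ j → Σ-exponents n (M ∸ j) (G ∘ (p ^ j ∷_)))

  sumMap-vecsOver-p^ : ∀ n M K (G : Vec ℕ n → ℤ) → p ^ M ≤ K →
    sumMap (λ v → if does (prodVec v ≟ p ^ M) then G v else 0ℤ) (vecsOver n (oneTo K)) ≡ Σ-exponents n M G
  sumMap-vecsOver-p^ zero M K G _ =
    trans (ℤ.+-identityʳ _) (if-cong (1 ≟ p ^ M) (M ≟ 0) 1≡p^⇒≡0 (λ { refl → refl }))
  sumMap-vecsOver-p^ (suc n) M K G p^M≤K = begin
      sumMap F (concatMap (λ x → map (x ∷_) (vecsOver n L)) L)
    ≡⟨ sumMap-concatMap F (λ x → map (x ∷_) (vecsOver n L)) L ⟩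
      sumMap (λ x → sumMap F (map (x ∷_) (vecsOver n L))) L
    ≡⟨ sumMap-cong (λ x → sumMap-map F (x ∷_) (vecsOver n L)) L ⟩
      sumMap Φ L
    ≡⟨ sumMap-oneTo Φ K ⟩
      Σ< K (Φ ∘ suc)
    ≡⟨ Σ<-divisors-p^ M K Φ p^M≤K Φ-∤ ⟩
      Σ< (suc M) (Φ ∘ (p ^_))
    ≡⟨ Σ<-cong (suc M) (λ j j<1+M → Φ-p^ j (ℕ.≤-pred j<1+M)) ⟩
      Σ-exponents (suc n) M G ∎
    where
    open ≡-Reasoning
    L : List ℕ
    L = oneTo K
    F : Vec ℕ (suc n) → ℤ
    F v = if does (prodVec v ≟ p ^ M) then G v else 0ℤ
    Φ : ℕ → ℤ
    Φ x = sumMap (λ w → F (x ∷ w)) (vecsOver n L)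
    Φ-∤ : ∀ x → ¬ x ∣ p ^ M → Φ x ≡ 0ℤ
    Φ-∤ x x∤ = sumMap-zero (λ w → if-false (x ℕ.* prodVec w ≟ p ^ M)
                 (λ xw≡ → x∤ (divides (prodVec w) (trans (sym xw≡) (ℕ.*-comm x (prodVec w)))))) (vecsOver n L)
    Φ-p^ : ∀ j → j ≤ M → Φ (p ^ j) ≡ Σ-exponents n (M ∸ j) (G ∘ (p ^ j ∷_))
    Φ-p^ j j≤M = trans
      (sumMap-cong (λ w → if-cong (p ^ j ℕ.* prodVec w ≟ p ^ M) (prodVec w ≟ p ^ (M ∸ j))
        (λ e → ℕ.*-cancelˡ-≡ _ _ (p ^ j) {{p^-nonZero j}} (trans e (sym (p^-split j≤M))))
        (λ e → trans (cong (p ^ j ℕ.*_) e) (p^-split j≤M))) (vecsOver n L))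
      (sumMap-vecsOver-p^ n (M ∸ j) K (G ∘ (p ^ j ∷_))
        (ℕ.≤-trans (ℕ.^-monoʳ-≤ p (ℕ.m∸n≤m M j)) p^M≤K))

  sumMap-factorisations-p^ : ∀ n M (G : Vec ℕ n → ℤ) →
    sumMap G (factorisations n (p ^ M)) ≡ Σ-exponents n M G
  sumMap-factorisations-p^ n M G =
    trans (sumMap-filter (λ v → prodVec v ≟ p ^ M) G (vecsOver n (oneTo (p ^ M))))
          (sumMap-vecsOver-p^ n M (p ^ M) G ℕ.≤-refl)

  +a-p^ : ∀ n M → + a n (p ^ M) ≡ Σ-exponents n M (+_ ∘ aSummand n)
  +a-p^ n M = trans (+sumℕ-map (aSummand n) (factorisations n (p ^ M)))
                    (sumMap-factorisations-p^ n M (+_ ∘ aSummand n))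

  a′-p^ : ∀ n M → a′ n (p ^ M) ≡ Σ-exponents n M (a′Summand n)
  a′-p^ n M = sumMap-factorisations-p^ n M (a′Summand n)

  Σ-exponents-2 : ∀ M G → Σ-exponents 2 M G ≡ Σ< (suc M) (λ j → G (p ^ j ∷ p ^ (M ∸ j) ∷ []))
  Σ-exponents-2 M G = Σ<-cong (suc M) (λ j _ → Σ<-last (M ∸ j) (λ k → G (p ^ j ∷ p ^ k ∷ [])))

  Σ-exponents-3 : ∀ M G → Σ-exponents 3 M G ≡
    Σ< (suc M) (λ i → Σ< (suc (M ∸ i)) (λ j → G (p ^ i ∷ p ^ j ∷ p ^ (M ∸ i ∸ j) ∷ [])))
  Σ-exponents-3 M G = Σ<-cong (suc M) (λ i _ → Σ-exponents-2 (M ∸ i) (G ∘ (p ^ i ∷_)))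

  P : ℤ
  P = + p

  T : ℕ → ℤ
  T k = + (p ^ k)

  T-suc : ∀ k → T (suc k) ≡ P * T k
  T-suc k = ℤ.pos-* p (p ^ k)

  T-2+ : ∀ k → T (2 ℕ.+ k) ≡ P * (P * T k)
  T-2+ k = trans (T-suc (suc k)) (cong (P *_) (T-suc k))

  T-3+ : ∀ k → T (3 ℕ.+ k) ≡ P * (P * (P * T k))
  T-3+ k = trans (T-suc (2 ℕ.+ k)) (cong (P *_) (T-2+ k))

  T-pos : ∀ k → 0ℤ ℤ.< T k
  T-pos k = ℤ.+<+ (ℕ.m^n>0 p k)

  P-1-pos : 0ℤ ℤ.< P - 1ℤ
  P-1-pos = ℤ.+<+ z<s

  P*T-1-pos : ∀ k → 0ℤ ℤ.< P * T k - 1ℤ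
  P*T-1-pos k = subst (λ x → 0ℤ ℤ.< x - 1ℤ) (T-suc k) (+-1-pos (1<p^suc k))

  J0-p^suc : ∀ k → J 0 (p ^ suc k) ≡ 0ℤ
  J0-p^suc = J-p^suc 0

  φ ψ : ℕ → ℤ
  φ k = J 1 (p ^ k)
  ψ k = J 2 (p ^ k)

  φ-suc : ∀ k → φ (suc k) ≡ (P - 1ℤ) * T k
  φ-suc k = begin
      φ (suc k)
    ≡⟨ J-p^suc 1 k ⟩
      + ((p ^ suc k) ^ 1) - + ((p ^ k) ^ 1)
    ≡⟨ cong₂ (λ x y → + x - + y) (ℕ.^-identityʳ (p ^ suc k)) (ℕ.^-identityʳ (p ^ k)) ⟩
      T (suc k) - T k
    ≡⟨ cong (_- T k) (T-suc k) ⟩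
      P * T k - T k
    ≡⟨ factor P (T k) ⟩
      (P - 1ℤ) * T k ∎
    where
    open ≡-Reasoning
    factor : ∀ P X → P * X - X ≡ (P - 1ℤ) * X
    factor = solve-∀

  ψ-suc : ∀ k → ψ (suc k) ≡ T (suc k) * T (suc k) - T k * T k
  ψ-suc k = trans (J-p^suc 2 k) (cong₂ _-_ (+[x^2] (p ^ suc k)) (+[x^2] (p ^ k)))
    where
    +[x^2] : ∀ x → + (x ^ 2) ≡ + x * + x
    +[x^2] x = trans (cong (λ y → + (x ℕ.* y)) (ℕ.*-identityʳ x)) (ℤ.pos-* x x)

  A₂ : ℕ → ℤ
  A₂ m = Σ< (suc m) (λ j → T (m ∸ j))

  +a₂ : ∀ m → + a 2 (p ^ m) ≡ A₂ m
  +a₂ m = trans (+a-p^ 2 m) (trans (Σ-exponents-2 m (+_ ∘ aSummand 2))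
    (Σ<-cong (suc m) (λ j _ → cong +_ (aSummand-2 (p ^ j) (p ^ (m ∸ j))))))

  a′₂ : ∀ m → a′ 2 (p ^ m) ≡ φ m
  a′₂ m = begin
      a′ 2 (p ^ m)
    ≡⟨ trans (a′-p^ 2 m) (Σ-exponents-2 m (a′Summand 2)) ⟩
      Σ< (suc m) (λ j → J 0 (p ^ j) * (J 1 (p ^ (m ∸ j)) * 1ℤ))
    ≡⟨ Σ<-head m (λ j → J 0 (p ^ j) * (J 1 (p ^ (m ∸ j)) * 1ℤ))
         (λ j → cong (_* (φ (m ∸ suc j) * 1ℤ)) (J0-p^suc j)) ⟩
      J 0 1 * (φ m * 1ℤ)
    ≡⟨ trans (cong (_* (φ m * 1ℤ)) (J-p^0 0)) (trans (ℤ.*-identityˡ (φ m * 1ℤ)) (ℤ.*-identityʳ (φ m))) ⟩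
      φ m ∎
    where open ≡-Reasoning

  A₂-closed : ∀ m → (P - 1ℤ) * A₂ m ≡ P * T m - 1ℤ
  A₂-closed zero    = algebra P
    where
    algebra : ∀ P → (P - 1ℤ) * 1ℤ ≡ P * 1ℤ - 1ℤ
    algebra = solve-∀
  A₂-closed (suc m) = begin
      (P - 1ℤ) * (T (suc m) + A₂ m)
    ≡⟨ ℤ.*-distribˡ-+ (P - 1ℤ) (T (suc m)) (A₂ m) ⟩
      (P - 1ℤ) * T (suc m) + (P - 1ℤ) * A₂ m
    ≡⟨ cong₂ (λ y z → (P - 1ℤ) * y + z) (T-suc m) (A₂-closed m) ⟩
      (P - 1ℤ) * (P * T m) + (P * T m - 1ℤ)
    ≡⟨ algebra P (T m) ⟩
      P * (P * T m) - 1ℤ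
    ≡⟨ cong (λ y → P * y - 1ℤ) (T-suc m) ⟨
      P * T (suc m) - 1ℤ ∎
    where
    open ≡-Reasoning
    algebra : ∀ P X → (P - 1ℤ) * (P * X) + (P * X - 1ℤ) ≡ P * (P * X) - 1ℤ
    algebra = solve-∀

  A₂-pos : ∀ m → 0ℤ ℤ.< A₂ m
  A₂-pos m = *-cancelˡ-pos (P - 1ℤ) P-1-pos (subst (0ℤ ℤ.<_) (sym (A₂-closed m)) (P*T-1-pos m))

  conv : (ℕ → ℤ) → ℕ → ℤ
  conv h m = Σ< (suc m) (λ j → T j * h (m ∸ j))

  conv-suc : ∀ h m → conv h (suc m) ≡ h (suc m) + P * conv h m
  conv-suc h m = cong₂ _+_ (ℤ.*-identityˡ (h (suc m))) (begin
      Σ< (suc m) (λ j → T (suc j) * h (m ∸ j))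
    ≡⟨ Σ<-cong (suc m) (λ j _ → trans (cong (_* h (m ∸ j)) (T-suc j)) (ℤ.*-assoc P (T j) (h (m ∸ j)))) ⟩
      Σ< (suc m) (λ j → P * (T j * h (m ∸ j)))
    ≡⟨ Σ<-*ˡ P (λ j → T j * h (m ∸ j)) (suc m) ⟩
      P * conv h m ∎)
    where open ≡-Reasoning

  c : ℕ → ℤ
  c = conv (λ k → T k * T k)

  A₃ : ℕ → ℤ
  A₃ m = Σ< (suc m) (λ i → c (m ∸ i))

  +a₃ : ∀ m → + a 3 (p ^ m) ≡ A₃ m
  +a₃ m = trans (+a-p^ 3 m) (trans (Σ-exponents-3 m (+_ ∘ aSummand 3))
    (Σ<-cong (suc m) (λ i _ → Σ<-cong (suc (m ∸ i)) (λ j _ → +summand (p ^ j) (p ^ (m ∸ i ∸ j))))))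
    where
    +summand : ∀ y z → + aSummand 3 (1 ∷ y ∷ z ∷ []) ≡ + y * (+ z * + z)
    +summand y z = trans (cong +_ (aSummand-3 1 y z)) (trans (ℤ.pos-* y (z ℕ.* z)) (cong (+ y *_) (ℤ.pos-* z z)))

  B₃ : ℕ → ℤ
  B₃ m = Σ< (suc m) (λ j → φ j * ψ (m ∸ j))

  B₃-0 : B₃ 0 ≡ 1ℤ
  B₃-0 = cong₂ (λ x y → x * y + 0ℤ) (J-p^0 1) (J-p^0 2)

  a′₃ : ∀ m → a′ 3 (p ^ m) ≡ B₃ m
  a′₃ m = begin
      a′ 3 (p ^ m)
    ≡⟨ trans (a′-p^ 3 m) (Σ-exponents-3 m (a′Summand 3)) ⟩
      Σ< (suc m) (λ i → Σ< (suc (m ∸ i)) (λ j → summand i j))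
    ≡⟨ Σ<-head m (λ i → Σ< (suc (m ∸ i)) (λ j → summand i j))
         (λ i → Σ<-zero (suc (m ∸ suc i)) (λ j → cong (_* (φ j * (ψ (m ∸ suc i ∸ j) * 1ℤ))) (J0-p^suc i))) ⟩
      Σ< (suc m) (λ j → summand 0 j)
    ≡⟨ Σ<-cong {summand 0} (suc m)
         (λ j _ → trans (cong (_* (φ j * (ψ (m ∸ j) * 1ℤ))) (J-p^0 0)) (unit (φ j) (ψ (m ∸ j)))) ⟩
      B₃ m ∎
    where
    open ≡-Reasoning
    summand : ℕ → ℕ → ℤ
    summand i j = J 0 (p ^ i) * (φ j * (ψ (m ∸ i ∸ j) * 1ℤ))
    unit : ∀ x y → 1ℤ * (x * (y * 1ℤ)) ≡ x * y
    unit = solve-∀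

  E : ℕ → ℤ
  E = conv ψ

  B₃-suc : ∀ m → B₃ (suc m) ≡ ψ (suc m) + (P - 1ℤ) * E m
  B₃-suc m = cong₂ _+_ (trans (cong (_* ψ (suc m)) (J-p^0 1)) (ℤ.*-identityˡ (ψ (suc m)))) (begin
      Σ< (suc m) (λ j → φ (suc j) * ψ (m ∸ j))
    ≡⟨ Σ<-cong (suc m)
         (λ j _ → trans (cong (_* ψ (m ∸ j)) (φ-suc j)) (ℤ.*-assoc (P - 1ℤ) (T j) (ψ (m ∸ j)))) ⟩
      Σ< (suc m) (λ j → (P - 1ℤ) * (T j * ψ (m ∸ j)))
    ≡⟨ Σ<-*ˡ (P - 1ℤ) (λ j → T j * ψ (m ∸ j)) (suc m) ⟩
      (P - 1ℤ) * E m ∎)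
    where open ≡-Reasoning

  c-closed : ∀ m → (P - 1ℤ) * c m ≡ P * T m * T m - T m
  c-closed zero    = algebra P
    where
    algebra : ∀ P → (P - 1ℤ) * 1ℤ ≡ P * 1ℤ * 1ℤ - 1ℤ
    algebra = solve-∀
  c-closed (suc m) = begin
      (P - 1ℤ) * c (suc m)
    ≡⟨ cong ((P - 1ℤ) *_) (conv-suc (λ k → T k * T k) m) ⟩
      (P - 1ℤ) * (Y * Y + P * c m)
    ≡⟨ distrib P Y (c m) ⟩
      (P - 1ℤ) * (Y * Y) + P * ((P - 1ℤ) * c m)
    ≡⟨ cong₂ (λ y z → (P - 1ℤ) * (y * y) + P * z) (T-suc m) (c-closed m) ⟩
      (P - 1ℤ) * (P * X * (P * X)) + P * (P * X * X - X)
    ≡⟨ algebra P X ⟩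
      P * (P * X) * (P * X) - P * X
    ≡⟨ cong (λ y → P * y * y - y) (T-suc m) ⟨
      P * Y * Y - Y ∎
    where
    open ≡-Reasoning
    X Y : ℤ
    X = T m
    Y = T (suc m)
    distrib : ∀ P Y C → (P - 1ℤ) * (Y * Y + P * C) ≡ (P - 1ℤ) * (Y * Y) + P * ((P - 1ℤ) * C)
    distrib = solve-∀
    algebra : ∀ P X → (P - 1ℤ) * (P * X * (P * X)) + P * (P * X * X - X) ≡ P * (P * X) * (P * X) - P * X
    algebra = solve-∀

  K : ℤ
  K = (P - 1ℤ) * (P * P - 1ℤ)

  A₃-closed : ∀ m → K * A₃ m ≡ (P * T m - 1ℤ) * (P * T (suc m) - 1ℤ)
  A₃-closed zero    = trans (algebra P) (cong (λ y → (P * 1ℤ - 1ℤ) * (P * y - 1ℤ)) (T-suc 0))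
    where
    algebra : ∀ P → (P - 1ℤ) * (P * P - 1ℤ) * 1ℤ ≡ (P * 1ℤ - 1ℤ) * (P * (P * 1ℤ) - 1ℤ)
    algebra = solve-∀
  A₃-closed (suc m) = begin
      K * (c (suc m) + A₃ m)
    ≡⟨ distrib P (c (suc m)) (A₃ m) ⟩
      (P * P - 1ℤ) * ((P - 1ℤ) * c (suc m)) + K * A₃ m
    ≡⟨ cong₂ (λ y z → (P * P - 1ℤ) * y + z) (c-closed (suc m)) (A₃-closed m) ⟩
      (P * P - 1ℤ) * (P * Y * Y - Y) + (P * X - 1ℤ) * (P * Y - 1ℤ)
    ≡⟨ cong (λ y → (P * P - 1ℤ) * (P * y * y - y) + (P * X - 1ℤ) * (P * y - 1ℤ)) (T-suc m) ⟩
      (P * P - 1ℤ) * (P * (P * X) * (P * X) - P * X) + (P * X - 1ℤ) * (P * (P * X) - 1ℤ)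
    ≡⟨ algebra P X ⟩
      (P * (P * X) - 1ℤ) * (P * (P * (P * X)) - 1ℤ)
    ≡⟨ cong₂ (λ y z → (P * y - 1ℤ) * (P * z - 1ℤ)) (T-suc m) (T-2+ m) ⟨
      (P * Y - 1ℤ) * (P * T (2 ℕ.+ m) - 1ℤ) ∎
    where
    open ≡-Reasoning
    X Y : ℤ
    X = T m
    Y = T (suc m)
    distrib : ∀ P C A → (P - 1ℤ) * (P * P - 1ℤ) * (C + A)
                      ≡ (P * P - 1ℤ) * ((P - 1ℤ) * C) + (P - 1ℤ) * (P * P - 1ℤ) * A
    distrib = solve-∀
    algebra : ∀ P X → (P * P - 1ℤ) * (P * (P * X) * (P * X) - P * X) + (P * X - 1ℤ) * (P * (P * X) - 1ℤ)
                 ≡ (P * (P * X) - 1ℤ) * (P * (P * (P * X)) - 1ℤ)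
    algebra = solve-∀

  A₃-pos : ∀ m → 0ℤ ℤ.< A₃ m
  A₃-pos m = *-cancelˡ-pos K (ℤ.positive⁻¹ K)
    (subst (0ℤ ℤ.<_) (sym (A₃-closed m)) (*-pos (P*T-1-pos m) (P*T-1-pos (suc m))))

  E-closed : ∀ m → P * E m ≡ P * T m + (P + 1ℤ) * T m * (T m - 1ℤ)
  E-closed zero    = trans (cong (λ y → P * (1ℤ * y + 0ℤ)) (J-p^0 2)) (algebra P)
    where
    algebra : ∀ P → P * (1ℤ * 1ℤ + 0ℤ) ≡ P * 1ℤ + (P + 1ℤ) * 1ℤ * (1ℤ - 1ℤ)
    algebra = solve-∀
  E-closed (suc m) = begin
      P * E (suc m)
    ≡⟨ cong (P *_) (trans (conv-suc ψ m) (cong (_+ P * E m) (ψ-suc m))) ⟩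
      P * (Y * Y - X * X + P * E m)
    ≡⟨ distrib P (Y * Y - X * X) (E m) ⟩
      P * (Y * Y - X * X) + P * (P * E m)
    ≡⟨ cong₂ (λ y z → P * (y * y - X * X) + P * z) (T-suc m) (E-closed m) ⟩
      P * (P * X * (P * X) - X * X) + P * (P * X + (P + 1ℤ) * X * (X - 1ℤ))
    ≡⟨ algebra P X ⟩
      P * (P * X) + (P + 1ℤ) * (P * X) * (P * X - 1ℤ)
    ≡⟨ cong (λ y → P * y + (P + 1ℤ) * y * (y - 1ℤ)) (T-suc m) ⟨
      P * Y + (P + 1ℤ) * Y * (Y - 1ℤ) ∎
    where
    open ≡-Reasoning
    X Y : ℤ
    X = T m
    Y = T (suc m)
    distrib : ∀ P A B → P * (A + P * B) ≡ P * A + P * (P * B)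
    distrib = solve-∀
    algebra : ∀ P X → P * (P * X * (P * X) - X * X) + P * (P * X + (P + 1ℤ) * X * (X - 1ℤ))
                 ≡ P * (P * X) + (P + 1ℤ) * (P * X) * (P * X - 1ℤ)
    algebra = solve-∀

  B₃-closed : ∀ m → P * B₃ (suc m) ≡ (P - 1ℤ) * T m * ((P + 1ℤ) * (P + 1ℤ) * T m - 1ℤ)
  B₃-closed m = begin
      P * B₃ (suc m)
    ≡⟨ cong (P *_) (B₃-suc m) ⟩
      P * (ψ (suc m) + (P - 1ℤ) * E m)
    ≡⟨ distrib P (ψ (suc m)) (E m) ⟩
      P * ψ (suc m) + (P - 1ℤ) * (P * E m)
    ≡⟨ cong₂ (λ y z → P * y + (P - 1ℤ) * z) (ψ-suc m) (E-closed m) ⟩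
      P * (T (suc m) * T (suc m) - X * X) + (P - 1ℤ) * (P * X + (P + 1ℤ) * X * (X - 1ℤ))
    ≡⟨ cong (λ y → P * (y * y - X * X) + (P - 1ℤ) * (P * X + (P + 1ℤ) * X * (X - 1ℤ))) (T-suc m) ⟩
      P * (P * X * (P * X) - X * X) + (P - 1ℤ) * (P * X + (P + 1ℤ) * X * (X - 1ℤ))
    ≡⟨ algebra P X ⟩
      (P - 1ℤ) * X * ((P + 1ℤ) * (P + 1ℤ) * X - 1ℤ) ∎
    where
    open ≡-Reasoning
    X : ℤ
    X = T m
    distrib : ∀ P A B → P * (A + (P - 1ℤ) * B) ≡ P * A + (P - 1ℤ) * (P * B)
    distrib = solve-∀
    algebra : ∀ P X → P * (P * X * (P * X) - X * X) + (P - 1ℤ) * (P * X + (P + 1ℤ) * X * (X - 1ℤ))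
                 ≡ (P - 1ℤ) * X * ((P + 1ℤ) * (P + 1ℤ) * X - 1ℤ)
    algebra = solve-∀

  φ/A₂-decreasing : ∀ m → φ (suc m) * A₂ m ℤ.< φ m * A₂ (suc m)
  φ/A₂-decreasing zero    =
    <-by-cross-scaling 1ℤ (P - 1ℤ) {φ 0} {φ 1} {A₂ 0} {A₂ 1} d (ℤ.positive⁻¹ 1ℤ) P-1-pos (ℤ.positive⁻¹ d) (begin
      1ℤ * φ 0 * ((P - 1ℤ) * A₂ 1)
    ≡⟨ cong₂ (λ f x → 1ℤ * f * x) (J-p^0 1) (trans (A₂-closed 1) (cong (λ t → P * t - 1ℤ) (T-suc 0))) ⟩
      1ℤ * 1ℤ * (P * (P * 1ℤ) - 1ℤ)
    ≡⟨ algebra P ⟩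
      1ℤ * ((P - 1ℤ) * 1ℤ) * (P * 1ℤ - 1ℤ) + d
    ≡⟨ cong₂ (λ f x → 1ℤ * f * x + d) (φ-suc 0) (A₂-closed 0) ⟨
      1ℤ * φ 1 * ((P - 1ℤ) * A₂ 0) + d ∎)
    where
    open ≡-Reasoning
    d : ℤ
    d = + 2 * (P - 1ℤ)
    algebra : ∀ P → 1ℤ * 1ℤ * (P * (P * 1ℤ) - 1ℤ)
                  ≡ 1ℤ * ((P - 1ℤ) * 1ℤ) * (P * 1ℤ - 1ℤ) + + 2 * (P - 1ℤ)
    algebra = solve-∀
  φ/A₂-decreasing (suc k) =
    <-by-cross-scaling 1ℤ (P - 1ℤ) {φ (suc k)} {φ (2 ℕ.+ k)} {A₂ (suc k)} {A₂ (2 ℕ.+ k)} d (ℤ.positive⁻¹ 1ℤ) P-1-pos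
    (*-pos (*-pos P-1-pos P-1-pos) (T-pos k)) (begin
      1ℤ * φ (suc k) * ((P - 1ℤ) * A₂ (2 ℕ.+ k))
    ≡⟨ cong₂ (λ f x → 1ℤ * f * x) (φ-suc k)
         (trans (A₂-closed (2 ℕ.+ k)) (cong (λ t → P * t - 1ℤ) (T-2+ k))) ⟩
      1ℤ * ((P - 1ℤ) * X) * (P * (P * (P * X)) - 1ℤ)
    ≡⟨ algebra P X ⟩
      1ℤ * ((P - 1ℤ) * (P * X)) * (P * (P * X) - 1ℤ) + d
    ≡⟨ cong₂ (λ f x → 1ℤ * f * x + d) (trans (φ-suc (suc k)) (cong ((P - 1ℤ) *_) (T-suc k)))
                                     (trans (A₂-closed (suc k)) (cong (λ t → P * t - 1ℤ) (T-suc k))) ⟨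
      1ℤ * φ (2 ℕ.+ k) * ((P - 1ℤ) * A₂ (suc k)) + d ∎)
    where
    open ≡-Reasoning
    X d : ℤ
    X = T k
    d = (P - 1ℤ) * (P - 1ℤ) * X
    algebra : ∀ P X → 1ℤ * ((P - 1ℤ) * X) * (P * (P * (P * X)) - 1ℤ)
                 ≡ 1ℤ * ((P - 1ℤ) * (P * X)) * (P * (P * X) - 1ℤ) + (P - 1ℤ) * (P - 1ℤ) * X
    algebra = solve-∀

  B₃/A₃-decreasing : ∀ m → B₃ (suc m) * A₃ m ℤ.< B₃ m * A₃ (suc m)
  B₃/A₃-decreasing zero    =
    <-by-cross-scaling P K {B₃ 0} {B₃ 1} {A₃ 0} {A₃ 1} d (ℤ.positive⁻¹ P) (ℤ.positive⁻¹ K) (ℤ.positive⁻¹ d) (begin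
      P * B₃ 0 * (K * A₃ 1)
    ≡⟨ cong₂ (λ b x → P * b * x) B₃-0
         (trans (A₃-closed 1) (cong₂ (λ s t → (P * s - 1ℤ) * (P * t - 1ℤ)) (T-suc 0) (T-2+ 0))) ⟩
      P * 1ℤ * ((P * (P * 1ℤ) - 1ℤ) * (P * (P * (P * 1ℤ)) - 1ℤ))
    ≡⟨ algebra P ⟩
      (P - 1ℤ) * 1ℤ * ((P + 1ℤ) * (P + 1ℤ) * 1ℤ - 1ℤ) * ((P * 1ℤ - 1ℤ) * (P * (P * 1ℤ) - 1ℤ)) + d
    ≡⟨ cong₂ (λ b x → b * x + d) (B₃-closed 0)
         (trans (A₃-closed 0) (cong (λ t → (P * 1ℤ - 1ℤ) * (P * t - 1ℤ)) (T-suc 0))) ⟨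
      P * B₃ 1 * (K * A₃ 0) + d ∎)
    where
    open ≡-Reasoning
    d : ℤ
    d = + 3 * P * (P - 1ℤ) * (P - 1ℤ) * (P + 1ℤ)
    algebra : ∀ P → P * 1ℤ * ((P * (P * 1ℤ) - 1ℤ) * (P * (P * (P * 1ℤ)) - 1ℤ))
               ≡ (P - 1ℤ) * 1ℤ * ((P + 1ℤ) * (P + 1ℤ) * 1ℤ - 1ℤ) * ((P * 1ℤ - 1ℤ) * (P * (P * 1ℤ) - 1ℤ))
                 + + 3 * P * (P - 1ℤ) * (P - 1ℤ) * (P + 1ℤ)
    algebra = solve-∀
  B₃/A₃-decreasing (suc k) =
    <-by-cross-scaling P K {B₃ (suc k)} {B₃ (2 ℕ.+ k)} {A₃ (suc k)} {A₃ (2 ℕ.+ k)} d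
      (ℤ.positive⁻¹ P) (ℤ.positive⁻¹ K) d-pos (begin
      P * B₃ (suc k) * (K * A₃ (2 ℕ.+ k))
    ≡⟨ cong₂ _*_ (B₃-closed k)
         (trans (A₃-closed (2 ℕ.+ k)) (cong₂ (λ s t → (P * s - 1ℤ) * (P * t - 1ℤ)) (T-2+ k) (T-3+ k))) ⟩
      (P - 1ℤ) * X * ((P + 1ℤ) * (P + 1ℤ) * X - 1ℤ) * ((P * (P * (P * X)) - 1ℤ) * (P * (P * (P * (P * X))) - 1ℤ))
    ≡⟨ algebra P X ⟩
      (P - 1ℤ) * (P * X) * ((P + 1ℤ) * (P + 1ℤ) * (P * X) - 1ℤ) * ((P * (P * X) - 1ℤ) * (P * (P * (P * X)) - 1ℤ)) + d
    ≡⟨ cong₂ (λ b x → b * x + d)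
         (trans (B₃-closed (suc k)) (cong (λ t → (P - 1ℤ) * t * ((P + 1ℤ) * (P + 1ℤ) * t - 1ℤ)) (T-suc k)))
         (trans (A₃-closed (suc k)) (cong₂ (λ s t → (P * s - 1ℤ) * (P * t - 1ℤ)) (T-suc k) (T-2+ k))) ⟨
      P * B₃ (2 ℕ.+ k) * (K * A₃ (suc k)) + d ∎)
    where
    open ≡-Reasoning
    X d : ℤ
    X = T k
    d = (P - 1ℤ) * (P - 1ℤ) * X * (P * (P * (P * X)) - 1ℤ) * ((P * X - 1ℤ) + X * (+ 3 * P * P + + 2 * P + 1ℤ))
    d-pos : 0ℤ ℤ.< d
    d-pos = *-pos (*-pos (*-pos (*-pos P-1-pos P-1-pos) (T-pos k))
                         (subst (λ t → 0ℤ ℤ.< P * t - 1ℤ) (T-2+ k) (P*T-1-pos (2 ℕ.+ k))))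
                  (+-pos (P*T-1-pos k) (*-pos (T-pos k) (ℤ.positive⁻¹ _)))
    algebra : ∀ P X →
      (P - 1ℤ) * X * ((P + 1ℤ) * (P + 1ℤ) * X - 1ℤ) * ((P * (P * (P * X)) - 1ℤ) * (P * (P * (P * (P * X))) - 1ℤ))
      ≡ (P - 1ℤ) * (P * X) * ((P + 1ℤ) * (P + 1ℤ) * (P * X) - 1ℤ) * ((P * (P * X) - 1ℤ) * (P * (P * (P * X)) - 1ℤ))
        + (P - 1ℤ) * (P - 1ℤ) * X * (P * (P * (P * X)) - 1ℤ) * ((P * X - 1ℤ) + X * (+ 3 * P * P + + 2 * P + 1ℤ))
    algebra = solve-∀

  D-p^suc<D-p^ : ∀ n (A B : ℕ → ℤ) → (∀ m → + a n (p ^ m) ≡ A m) → (∀ m → a′ n (p ^ m) ≡ B m) →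
    (∀ m → 0ℤ ℤ.< A m) → (∀ m → B (suc m) * A m ℤ.< B m * A (suc m)) →
    ∀ m → D n (p ^ suc m) <ℚ D n (p ^ m)
  D-p^suc<D-p^ n A B a≡A a′≡B A-pos ratio m =
    divℚ-< (a′ n (p ^ suc m)) (a′ n (p ^ m)) (a-pos (suc m)) (a-pos m)
      (subst₂ ℤ._<_ (sym (cong₂ _*_ (a′≡B (suc m)) (a≡A m))) (sym (cong₂ _*_ (a′≡B m) (a≡A (suc m))))
                    (ratio m))
    where
    a-pos : ∀ m → 0 < a n (p ^ m)
    a-pos m = ℤ.drop‿+<+ (subst (0ℤ ℤ.<_) (sym (a≡A m)) (A-pos m))

  D₂-p^suc<D₂-p^ : ∀ m → D 2 (p ^ suc m) <ℚ D 2 (p ^ m)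
  D₂-p^suc<D₂-p^ = D-p^suc<D-p^ 2 A₂ φ +a₂ a′₂ A₂-pos φ/A₂-decreasing

  D₃-p^suc<D₃-p^ : ∀ m → D 3 (p ^ suc m) <ℚ D 3 (p ^ m)
  D₃-p^suc<D₃-p^ = D-p^suc<D-p^ 3 A₃ B₃ +a₃ a′₃ A₃-pos B₃/A₃-decreasing

<-from-successor : (f : ℕ → ℚ) → (∀ m → f (suc m) <ℚ f m) → ∀ {m m′} → m < m′ → f m′ <ℚ f m
<-from-successor f f-suc< {m} {suc m′} (s≤s m≤m′) with ℕ.m≤n⇒m<n∨m≡n m≤m′
... | inj₁ m<m′ = ℚ.<-trans (f-suc< m′) (<-from-successor f f-suc< m<m′)
... | inj₂ refl = f-suc< m

proposition19 : (n : ℕ) → (n ≡ 2 ⊎ n ≡ 3) → (p : ℕ) → Prime p →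
    (m m′ : ℕ) → m < m′ → D n (p ^ m′) <ℚ D n (p ^ m)
proposition19 n _ 0 p-prime = ⊥-elim (¬prime[0] p-prime)
proposition19 n _ 1 p-prime = ⊥-elim (¬prime[1] p-prime)
proposition19 2 (inj₁ refl) (suc (suc q)) p-prime m m′ =
  <-from-successor (λ k → D 2 (suc (suc q) ^ k)) (PrimePower.D₂-p^suc<D₂-p^ q p-prime)
proposition19 3 (inj₂ refl) (suc (suc q)) p-prime m m′ =
  <-from-successor (λ k → D 3 (suc (suc q) ^ k)) (PrimePower.D₃-p^suc<D₃-p^ q p-prime)
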